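{- For every integer $n \ge 4$, the doubly metric dimension of the Johnson graph $J_{n,2}$ is $\psi(J_{n,2}) = \lceil 2n/3 \rceil$.
   Context: The Johnson graph $J_{n,2}$ has as vertices all $2$-element subsets of $[n]=\{1,\dots,n\}$, two being adjacent iff they share exactly one element; $d$ denotes shortest-path distance. Vertices $x,y$ doubly resolve vertices $u,v$ if $d(u,x)-d(u,y)\ne d(v,x)-d(v,y)$. A vertex set $D$ is a doubly resolving set if every two distinct vertices are doubly resolved by some two vertices of $D$; $\psi(G)$ is the minimum cardinality of a doubly resolving set of $G$. -}

module Defs where

open import Data.Nat using (ℕ; zero; suc; _+_; _*_; _≤_)
open import Data.Nat.DivMod using (_/_)
open import Data.Fin using (Fin; _<_; _≟_)
open import Data.Integer using (ℤ; +_; _-_)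
open import Data.Product using (Σ; ∃; _×_; _,_)
open import Data.Sum using (_⊎_)
open import Data.List using (List; length)
open import Data.List.Membership.Propositional using (_∈_)
open import Data.List.Relation.Unary.Unique.Propositional using (Unique)
open import Relation.Nullary using (¬_; Dec; yes; no)
open import Relation.Binary.PropositionalEquality using (_≡_; _≢_)

-- A vertex of J_{n,2}: a 2-element subset {i , j} of Fin n, written with i < j
-- (so each 2-subset has exactly one representation).
record V (n : ℕ) : Set where
  constructor ⟨_,_∣_⟩
  field
    fst : Fin n
    snd : Fin n
    fst<snd : fst < snd

open V public

[_≟_] : ∀ {n} → Fin n → Fin n → ℕ
[ a ≟ b ] with a ≟ b
... | yes _ = 1
... | no _ = 0

common : ∀ {n} → V n → V n → ℕ
common u v = [ fst u ≟ fst v ] + [ fst u ≟ snd v ] + [ snd u ≟ fst v ] + [ snd u ≟ snd v ]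

Adj : ∀ {n} → V n → V n → Set
Adj u v = common u v ≡ 1

Reach : ∀ {n} → ℕ → V n → V n → Set
Reach zero u v = u ≡ v
Reach (suc k) u v = Reach k u v ⊎ (∃ λ w → Reach k u w × Adj w v)

Dist : ∀ {n} → V n → V n → ℕ → Set
Dist u v zero = u ≡ v
Dist u v (suc k) = Reach (suc k) u v × ¬ Reach k u v

DoublyResolves : ∀ {n} → V n → V n → V n → V n → Set
DoublyResolves x y u v =
  ∀ a b c e → Dist u x a → Dist u y b → Dist v x c → Dist v y e →
  (+ a - + b) ≢ (+ c - + e)

-- D (a duplicate-free list of vertices, i.e. a finite vertex set) is doubly resolving
IsDoublyResolving : ∀ {n} → List (V n) → Set
IsDoublyResolving {n} D =
  (u v : V n) → u ≢ v → ∃ λ x → ∃ λ y → x ∈ D × y ∈ D × DoublyResolves x y u v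

ψJ2≡ : ℕ → ℕ → Set
ψJ2≡ n m =
  (Σ (List (V n)) λ D → Unique D × IsDoublyResolving D × length D ≡ m)
  × ((D : List (V n)) → Unique D → IsDoublyResolving D → m ≤ length D)

-- ⌈ 2n/3 ⌉ = ⌊ (2n + 2) / 3 ⌋
ceil2n/3 : ℕ → ℕ
ceil2n/3 n = (2 * n + 2) / 3

module Submission where

-- Identify a vertex of J(n,2) with an edge of the complete graph on Fin n; then
-- d(u,x) = 2 − |u ∩ x|, and x, y fail to doubly resolve u, v exactly when
-- |u ∩ x| − |v ∩ x| = |u ∩ y| − |v ∩ y|.  So a list D of vertices is doubly
-- resolving iff no two distinct u, v have profiles w ↦ |u ∩ w|, w ↦ |v ∩ w|
-- differing by a constant on D.
--
-- Read D as a graph on Fin n.  Comparing suitable pairs shows that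
-- D has at most one isolated point, no edge joining two leaves and no path
-- component a – b – c – d, and that an isolated point excludes a path component
-- a – b – d as well as a star containing every edge.  Counting degrees gives
--   3|D| + 2·#isolated = 2n + Σ (deg ∸ 2) + #(edges without a leaf end),
-- and these configurations force the last two terms to be at least 2·#isolated.
--
-- Let D contain every edge of a spanning forest of stars with at
-- least two leaves each.  A constant shift between the profiles of u ≠ v is
-- impossible: it must vanish (look at a point of u ∖ v and its star edge), and
-- then a centre in u ∖ v pushes two of its leaves into v, which leaves no room
-- for the second point of u.  With the ⌊n/3⌋ centres 0, …, ⌊n/3⌋ − 1 such a
-- forest has n − ⌊n/3⌋ = ⌈2n/3⌉ edges.

open import Defs
open import Algebra.Properties.CommutativeSemigroup as CommutativeSemigroupₚ using ()
open import Data.Empty using (⊥; ⊥-elim)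
open import Data.Fin as Fin using (Fin; toℕ; _≟_)
import Data.Fin.Properties as Finₚ
open import Data.Integer as ℤ using ()
import Data.Integer.Properties as ℤₚ
open import Data.Integer.Solver renaming (module +-*-Solver to ℤ-Solver)
open import Data.List using (List; []; _∷_; length; allFin; map)
open import Data.List.Properties using (length-map; length-tabulate)
open import Data.List.Membership.Propositional using (_∈_; _─_; find; lose)
open import Data.List.Membership.Propositional.Properties using (∈-allFin; ∈-map⁺)
import Data.List.Relation.Unary.All as All
open import Data.List.Relation.Unary.AllPairs using (_∷_)
open import Data.List.Relation.Unary.Any using (here; there; any?)
open import Data.List.Relation.Unary.Unique.Propositional using (Unique)
import Data.List.Relation.Unary.Unique.Propositional.Properties as Uniqueₚ
open import Data.Nat as ℕ using (ℕ; zero; suc; _+_; _*_; _∸_; _≤_; _<_; z≤n; s≤s; z<s)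
open import Data.Nat.DivMod
  using (_%_; _/_; m%n<n; m%n%n≡m%n; [m+kn]%n≡m%n; m<n⇒m%n≡m; m/n≡1+[m∸n]/n; m/n≤m;
         m<n*o⇒m/o<n; m≥n⇒m/n>0; m/n*n≤m)
open import Data.Nat.Properties hiding (_≟_)
open import Data.Nat.Solver using (module +-*-Solver)
open import Data.Product using (∃; ∃₂; _×_; _,_; proj₁; proj₂)
open import Data.Sum using (_⊎_; inj₁; inj₂)
open import Function using (_⇔_; mk⇔; Equivalence; id; _∘_; flip)
open import Relation.Binary.Definitions using (tri<; tri≈; tri>)
open import Relation.Binary.PropositionalEquality hiding ([_])
open import Relation.Nullary using (¬_; Dec; yes; no; ¬?)
open import Relation.Nullary.Decidable using (decidable-stable)

open CommutativeSemigroupₚ +-commutativeSemigroup using (interchange; x∙yz≈y∙xz; xy∙z≈xz∙y)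

private variable
  n : ℕ
  A P : Set

𝟙 : Dec P → ℕ
𝟙 (yes _) = 1
𝟙 (no _)  = 0

𝟙-yes : (d : Dec P) → P → 𝟙 d ≡ 1
𝟙-yes (yes _) _ = refl
𝟙-yes (no ¬p) p = ⊥-elim (¬p p)

𝟙-no : (d : Dec P) → ¬ P → 𝟙 d ≡ 0
𝟙-no (yes p) ¬p = ⊥-elim (¬p p)
𝟙-no (no _)  _  = refl

𝟙≡0⇒¬ : (d : Dec P) → 𝟙 d ≡ 0 → ¬ P
𝟙≡0⇒¬ (no ¬p) _ = ¬p

∑ : List A → (A → ℕ) → ℕ
∑ []       f = 0
∑ (x ∷ xs) f = f x + ∑ xs f

syntax ∑ xs (λ x → e) = ∑[ x ∈ xs ] e

∑-cong : (xs : List A) {f g : A → ℕ} → (∀ {x} → x ∈ xs → f x ≡ g x) → ∑ xs f ≡ ∑ xs g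
∑-cong []       f≗g = refl
∑-cong (y ∷ ys) f≗g = cong₂ _+_ (f≗g (here refl)) (∑-cong ys (f≗g ∘ there))

∑-zero : {xs : List A} {f : A → ℕ} → (∀ {x} → x ∈ xs → f x ≡ 0) → ∑ xs f ≡ 0
∑-zero {xs = []}     f≗0 = refl
∑-zero {xs = y ∷ ys} f≗0 = cong₂ _+_ (f≗0 (here refl)) (∑-zero (f≗0 ∘ there))

∑-distrib-+ : (xs : List A) (f g : A → ℕ) → ∑[ x ∈ xs ] (f x + g x) ≡ ∑ xs f + ∑ xs g
∑-distrib-+ []       f g = refl
∑-distrib-+ (x ∷ xs) f g =
  trans (cong ((f x + g x) +_) (∑-distrib-+ xs f g)) (interchange (f x) (g x) (∑ xs f) (∑ xs g))

∑-const : (xs : List A) (c : ℕ) → ∑[ x ∈ xs ] c ≡ length xs * c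
∑-const []       c = refl
∑-const (x ∷ xs) c = cong (c +_) (∑-const xs c)

*-distribˡ-∑ : (k : ℕ) (xs : List A) (f : A → ℕ) → k * ∑ xs f ≡ ∑[ x ∈ xs ] (k * f x)
*-distribˡ-∑ k []       f = *-zeroʳ k
*-distribˡ-∑ k (x ∷ xs) f = trans (*-distribˡ-+ k (f x) (∑ xs f)) (cong (k * f x +_) (*-distribˡ-∑ k xs f))

∑-comm : {B : Set} (xs : List A) (ys : List B) (F : A → B → ℕ) →
         ∑[ x ∈ xs ] ∑[ y ∈ ys ] F x y ≡ ∑[ y ∈ ys ] ∑[ x ∈ xs ] F x y
∑-comm []       ys F = sym (∑-zero {xs = ys} (λ _ → refl))
∑-comm (x ∷ xs) ys F = trans (cong (∑ ys (F x) +_) (∑-comm xs ys F))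
                             (sym (∑-distrib-+ ys (F x) (λ y → ∑[ x′ ∈ xs ] F x′ y)))

f≤∑ : {xs : List A} (f : A → ℕ) {x : A} → x ∈ xs → f x ≤ ∑ xs f
f≤∑ {xs = y ∷ ys} f (here refl)  = m≤m+n (f y) (∑ ys f)
f≤∑ {xs = y ∷ ys} f (there x∈ys) = ≤-trans (f≤∑ f x∈ys) (m≤n+m (∑ ys f) (f y))

∈-─ : {xs : List A} {x y : A} (x∈xs : x ∈ xs) → y ∈ xs → y ≢ x → y ∈ xs ─ x∈xs
∈-─ (here refl)  (here refl)  y≢x = ⊥-elim (y≢x refl)
∈-─ (here refl)  (there y∈ys) _   = y∈ys
∈-─ (there _)    (here refl)  _   = here refl
∈-─ (there x∈ys) (there y∈ys) y≢x = there (∈-─ x∈ys y∈ys y≢x)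

∑-─ : {xs : List A} (f : A → ℕ) {x : A} (x∈xs : x ∈ xs) → ∑ xs f ≡ f x + ∑ (xs ─ x∈xs) f
∑-─ f (here refl) = refl
∑-─ {xs = y ∷ ys} f {x} (there x∈ys) = begin
  f y + ∑ ys f                    ≡⟨ cong (f y +_) (∑-─ f x∈ys) ⟩
  f y + (f x + ∑ (ys ─ x∈ys) f)   ≡⟨ x∙yz≈y∙xz (f y) (f x) _ ⟩
  f x + (f y + ∑ (ys ─ x∈ys) f)   ∎
  where open ≡-Reasoning

f+f≤∑ : {xs : List A} (f : A → ℕ) {x y : A} → x ∈ xs → y ∈ xs → y ≢ x → f x + f y ≤ ∑ xs f
f+f≤∑ f {x} {y} x∈xs y∈xs y≢x =
  subst (f x + f y ≤_) (sym (∑-─ f x∈xs)) (+-monoʳ-≤ (f x) (f≤∑ f (∈-─ x∈xs y∈xs y≢x)))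

f+f+f≤∑ : {xs : List A} (f : A → ℕ) {x y z : A} → x ∈ xs → y ∈ xs → z ∈ xs →
          y ≢ x → z ≢ x → z ≢ y → f x + f y + f z ≤ ∑ xs f
f+f+f≤∑ {xs = xs} f {x} {y} {z} x∈xs y∈xs z∈xs y≢x z≢x z≢y = begin
  f x + f y + f z         ≡⟨ +-assoc (f x) (f y) (f z) ⟩
  f x + (f y + f z)       ≤⟨ +-monoʳ-≤ (f x) (f+f≤∑ f y∈xs∖x z∈xs∖x z≢y) ⟩
  f x + ∑ (xs ─ x∈xs) f   ≡⟨ ∑-─ f x∈xs ⟨
  ∑ xs f                  ∎
  where
  open ≤-Reasoning
  y∈xs∖x : y ∈ xs ─ x∈xs
  y∈xs∖x = ∈-─ x∈xs y∈xs y≢x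
  z∈xs∖x : z ∈ xs ─ x∈xs
  z∈xs∖x = ∈-─ x∈xs z∈xs z≢x

∑>0⇒∃ : (xs : List A) (f : A → ℕ) → 0 < ∑ xs f → ∃ λ x → x ∈ xs × 0 < f x
∑>0⇒∃ (x ∷ xs) f 0<∑ with f x in fx
... | suc _ = x , here refl , subst (0 <_) (sym fx) z<s
... | zero with ∑>0⇒∃ xs f 0<∑
...   | y , y∈xs , 0<fy = y , there y∈xs , 0<fy

f<∑⇒∃ : {xs : List A} (f : A → ℕ) {x : A} → Unique xs → x ∈ xs → f x < ∑ xs f →
        ∃ λ y → y ∈ xs × y ≢ x × 0 < f y
f<∑⇒∃ {xs = y ∷ ys} f (y∉ys ∷ _) (here refl) fy<∑
  with ∑>0⇒∃ ys f (+-cancelˡ-< (f y) 0 (∑ ys f) (subst (_< f y + ∑ ys f) (sym (+-identityʳ (f y))) fy<∑))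
... | z , z∈ys , 0<fz = z , there z∈ys , All.lookup y∉ys z∈ys ∘ sym , 0<fz
f<∑⇒∃ {xs = y ∷ ys} f {x} (y∉ys ∷ ys!) (there x∈ys) fx<∑ with f y in fy
... | suc _ = y , here refl , All.lookup y∉ys x∈ys , subst (0 <_) (sym fy) z<s
... | zero with f<∑⇒∃ f ys! x∈ys fx<∑
...   | z , z∈ys , z≢x , 0<fz = z , there z∈ys , z≢x , 0<fz

∑-supported : {xs : List A} (f : A → ℕ) {e : A} → Unique xs → e ∈ xs →
              (∀ {a} → a ∈ xs → a ≢ e → f a ≡ 0) → ∑ xs f ≡ f e
∑-supported {xs = y ∷ ys} f (y∉ys ∷ _) (here refl) vanishes =
  trans (cong (f y +_) (∑-zero (λ a∈ys → vanishes (there a∈ys) (All.lookup y∉ys a∈ys ∘ sym))))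
        (+-identityʳ (f y))
∑-supported {xs = y ∷ ys} f (y∉ys ∷ ys!) (there e∈ys) vanishes =
  cong₂ _+_ (vanishes (here refl) (All.lookup y∉ys e∈ys)) (∑-supported f ys! e∈ys (vanishes ∘ there))

∑-select : (f : Fin n → ℕ) (p : Fin n) → ∑[ a ∈ allFin n ] (f a * 𝟙 (a ≟ p)) ≡ f p
∑-select {n} f p = begin
  ∑[ a ∈ allFin n ] (f a * 𝟙 (a ≟ p))
    ≡⟨ ∑-supported (λ a → f a * 𝟙 (a ≟ p)) (Uniqueₚ.allFin⁺ n) (∈-allFin p) vanishes ⟩
  f p * 𝟙 (p ≟ p)   ≡⟨ cong (f p *_) (𝟙-yes (p ≟ p) refl) ⟩
  f p * 1           ≡⟨ *-identityʳ (f p) ⟩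
  f p               ∎
  where
  open ≡-Reasoning
  vanishes : ∀ {a} → a ∈ allFin n → a ≢ p → f a * 𝟙 (a ≟ p) ≡ 0
  vanishes {a} _ a≢p = trans (cong (f a *_) (𝟙-no (a ≟ p) a≢p)) (*-zeroʳ (f a))

-- Vertices of J(n,2)

[≟]≡𝟙 : (a b : Fin n) → [ a ≟ b ] ≡ 𝟙 (a ≟ b)
[≟]≡𝟙 a b with a ≟ b
... | yes _ = refl
... | no _  = refl

𝟙-≟-sym : (a b : Fin n) → 𝟙 (a ≟ b) ≡ 𝟙 (b ≟ a)
𝟙-≟-sym a b with a ≟ b
... | yes a≡b = sym (𝟙-yes (b ≟ a) (sym a≡b))
... | no a≢b  = sym (𝟙-no (b ≟ a) (a≢b ∘ sym))

V-≡ : {u v : V n} → fst u ≡ fst v → snd u ≡ snd v → u ≡ v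
V-≡ {u = ⟨ a , b ∣ p ⟩} {⟨ .a , .b ∣ q ⟩} refl refl = cong ⟨ a , b ∣_⟩ (<-irrelevant p q)

fst≢snd : (x : V n) → fst x ≢ snd x
fst≢snd x eq = <-irrefl (cong toℕ eq) (fst<snd x)

_≟ᵥ_ : (u v : V n) → Dec (u ≡ v)
u ≟ᵥ v with fst u ≟ fst v | snd u ≟ snd v
... | yes p | yes q = yes (V-≡ p q)
... | no ¬p | _     = no (¬p ∘ cong fst)
... | yes _ | no ¬q = no (¬q ∘ cong snd)

occ : Fin n → V n → ℕ
occ a x = 𝟙 (a ≟ fst x) + 𝟙 (a ≟ snd x)

occ-fst : (x : V n) → occ (fst x) x ≡ 1
occ-fst x = cong₂ _+_ (𝟙-yes (fst x ≟ fst x) refl) (𝟙-no (fst x ≟ snd x) (fst≢snd x))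

occ-snd : (x : V n) → occ (snd x) x ≡ 1
occ-snd x = cong₂ _+_ (𝟙-no (snd x ≟ fst x) (fst≢snd x ∘ sym)) (𝟙-yes (snd x ≟ snd x) refl)

occ≤1 : (a : Fin n) (x : V n) → occ a x ≤ 1
occ≤1 a x with a ≟ fst x | a ≟ snd x
... | yes p | yes q = ⊥-elim (fst≢snd x (trans (sym p) q))
... | yes _ | no _  = ≤-refl
... | no _  | yes _ = ≤-refl
... | no _  | no _  = z≤n

occ>0⇒≡1 : (a : Fin n) (x : V n) → 0 < occ a x → occ a x ≡ 1
occ>0⇒≡1 a x 0<occ = ≤-antisym (occ≤1 a x) 0<occ

occ≡1⇒ : {a : Fin n} (x : V n) → occ a x ≡ 1 → a ≡ fst x ⊎ a ≡ snd x
occ≡1⇒ {a = a} x a∈x with a ≟ fst x | a ≟ snd x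
occ≡1⇒ x a∈x | yes p | _     = inj₁ p
occ≡1⇒ x a∈x | no _  | yes q = inj₂ q
occ≡1⇒ x ()  | no _  | no _

occ-≢ : {a b : Fin n} (x : V n) → occ a x ≡ 0 → occ b x ≡ 1 → a ≢ b
occ-≢ x a∉x b∈x refl with trans (sym a∉x) b∈x
... | ()

only-two-elements : {p q a : Fin n} (x : V n) → p ≢ q →
                    occ p x ≡ 1 → occ q x ≡ 1 → occ a x ≡ 1 → a ≡ p ⊎ a ≡ q
only-two-elements x p≢q p∈x q∈x a∈x with occ≡1⇒ x p∈x | occ≡1⇒ x q∈x | occ≡1⇒ x a∈x
... | inj₁ p≡ | inj₁ q≡ | _       = ⊥-elim (p≢q (trans p≡ (sym q≡)))
... | inj₂ p≡ | inj₂ q≡ | _       = ⊥-elim (p≢q (trans p≡ (sym q≡)))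
... | inj₁ p≡ | inj₂ _  | inj₁ a≡ = inj₁ (trans a≡ (sym p≡))
... | inj₁ _  | inj₂ q≡ | inj₂ a≡ = inj₂ (trans a≡ (sym q≡))
... | inj₂ _  | inj₁ q≡ | inj₁ a≡ = inj₂ (trans a≡ (sym q≡))
... | inj₂ p≡ | inj₁ _  | inj₂ a≡ = inj₁ (trans a≡ (sym p≡))

≡-by-elements : {p q : Fin n} (x y : V n) → p ≢ q →
                occ p x ≡ 1 → occ q x ≡ 1 → occ p y ≡ 1 → occ q y ≡ 1 → x ≡ y
≡-by-elements x y p≢q p∈x q∈x p∈y q∈y
  with occ≡1⇒ x p∈x | occ≡1⇒ x q∈x | occ≡1⇒ y p∈y | occ≡1⇒ y q∈y
... | inj₁ p₁ | inj₁ q₁ | _       | _       = ⊥-elim (p≢q (trans p₁ (sym q₁)))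
... | inj₂ p₁ | inj₂ q₁ | _       | _       = ⊥-elim (p≢q (trans p₁ (sym q₁)))
... | _       | _       | inj₁ p₂ | inj₁ q₂ = ⊥-elim (p≢q (trans p₂ (sym q₂)))
... | _       | _       | inj₂ p₂ | inj₂ q₂ = ⊥-elim (p≢q (trans p₂ (sym q₂)))
... | inj₁ p₁ | inj₂ q₁ | inj₁ p₂ | inj₂ q₂ = V-≡ (trans (sym p₁) p₂) (trans (sym q₁) q₂)
... | inj₂ p₁ | inj₁ q₁ | inj₂ p₂ | inj₁ q₂ = V-≡ (trans (sym q₁) q₂) (trans (sym p₁) p₂)
... | inj₁ p₁ | inj₂ q₁ | inj₂ p₂ | inj₁ q₂ = ⊥-elim (<-asym
  (subst₂ (λ i j → toℕ i < toℕ j) (trans (sym p₁) p₂) (trans (sym q₁) q₂) (fst<snd x)) (fst<snd y))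
... | inj₂ p₁ | inj₁ q₁ | inj₁ p₂ | inj₂ q₂ = ⊥-elim (<-asym
  (subst₂ (λ i j → toℕ i < toℕ j) (trans (sym q₁) q₂) (trans (sym p₁) p₂) (fst<snd x)) (fst<snd y))

other-element : {z : Fin n} (u : V n) → occ z u ≡ 1 → ∃ λ y → y ≢ z × occ y u ≡ 1
other-element u z∈u with occ≡1⇒ u z∈u
... | inj₁ z≡fst = snd u , (λ eq → fst≢snd u (trans (sym z≡fst) (sym eq))) , occ-snd u
... | inj₂ z≡snd = fst u , (λ eq → fst≢snd u (trans eq z≡snd)) , occ-fst u

∃-difference : {u v : V n} → u ≢ v → ∃ λ z → occ z u ≡ 1 × occ z v ≡ 0
∃-difference {u = u} {v} u≢v
  with n≤1⇒n≡0∨n≡1 (occ≤1 (fst u) v) | n≤1⇒n≡0∨n≡1 (occ≤1 (snd u) v)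
... | inj₁ fst∉v | _          = fst u , occ-fst u , fst∉v
... | inj₂ _     | inj₁ snd∉v = snd u , occ-snd u , snd∉v
... | inj₂ fst∈v | inj₂ snd∈v =
  ⊥-elim (u≢v (≡-by-elements u v (fst≢snd u) (occ-fst u) (occ-snd u) fst∈v snd∈v))

≢∧≮⇒> : {a b : Fin n} → a ≢ b → ¬ a Fin.< b → b Fin.< a
≢∧≮⇒> a≢b a≮b = ≤∧≢⇒< (≮⇒≥ a≮b) (a≢b ∘ Finₚ.toℕ-injective ∘ sym)

pair : (a b : Fin n) → a ≢ b → V n
pair a b a≢b with a Fin.<? b
... | yes a<b = ⟨ a , b ∣ a<b ⟩
... | no a≮b  = ⟨ b , a ∣ ≢∧≮⇒> a≢b a≮b ⟩

occ-pair : (z a b : Fin n) (a≢b : a ≢ b) → occ z (pair a b a≢b) ≡ 𝟙 (z ≟ a) + 𝟙 (z ≟ b)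
occ-pair z a b a≢b with a Fin.<? b
... | yes _ = refl
... | no _  = +-comm (𝟙 (z ≟ b)) (𝟙 (z ≟ a))

occ-pairˡ : (a b : Fin n) (a≢b : a ≢ b) → occ a (pair a b a≢b) ≡ 1
occ-pairˡ a b a≢b = trans (occ-pair a a b a≢b) (cong₂ _+_ (𝟙-yes (a ≟ a) refl) (𝟙-no (a ≟ b) a≢b))

occ-pairʳ : (a b : Fin n) (a≢b : a ≢ b) → occ b (pair a b a≢b) ≡ 1
occ-pairʳ a b a≢b =
  trans (occ-pair b a b a≢b) (cong₂ _+_ (𝟙-no (b ≟ a) (a≢b ∘ sym)) (𝟙-yes (b ≟ b) refl))

pair-≡⇒ : {a b c d : Fin n} {a≢b : a ≢ b} {c≢d : c ≢ d} →
          pair a b a≢b ≡ pair c d c≢d → a ≡ c ⊎ a ≡ d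
pair-≡⇒ {a = a} {b} {c} {d} {a≢b} {c≢d} eq with a ≟ c | a ≟ d | occ-pair a c d c≢d
... | yes a≡c | _       | _ = inj₁ a≡c
... | no _    | yes a≡d | _ = inj₂ a≡d
... | no _    | no _    | a∉cd with trans (sym (occ-pairˡ a b a≢b)) (trans (cong (occ a) eq) a∉cd)
...   | ()

common-occ : (u x : V n) → common u x ≡ occ (fst u) x + occ (snd u) x
common-occ u x = begin
  common u x
    ≡⟨ +-assoc ([ fst u ≟ fst x ] + [ fst u ≟ snd x ]) [ snd u ≟ fst x ] [ snd u ≟ snd x ] ⟩
  ([ fst u ≟ fst x ] + [ fst u ≟ snd x ]) + ([ snd u ≟ fst x ] + [ snd u ≟ snd x ])
    ≡⟨ cong₂ _+_ (cong₂ _+_ ([≟]≡𝟙 (fst u) (fst x)) ([≟]≡𝟙 (fst u) (snd x)))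
                 (cong₂ _+_ ([≟]≡𝟙 (snd u) (fst x)) ([≟]≡𝟙 (snd u) (snd x))) ⟩
  occ (fst u) x + occ (snd u) x
    ∎
  where open ≡-Reasoning

common-comm : (u x : V n) → common u x ≡ common x u
common-comm u x = begin
  common u x
    ≡⟨ common-occ u x ⟩
  (𝟙 (fst u ≟ fst x) + 𝟙 (fst u ≟ snd x)) + (𝟙 (snd u ≟ fst x) + 𝟙 (snd u ≟ snd x))
    ≡⟨ interchange (𝟙 (fst u ≟ fst x)) (𝟙 (fst u ≟ snd x)) (𝟙 (snd u ≟ fst x)) _ ⟩
  (𝟙 (fst u ≟ fst x) + 𝟙 (snd u ≟ fst x)) + (𝟙 (fst u ≟ snd x) + 𝟙 (snd u ≟ snd x))
    ≡⟨ cong₂ _+_ (cong₂ _+_ (𝟙-≟-sym (fst u) (fst x)) (𝟙-≟-sym (snd u) (fst x)))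
                 (cong₂ _+_ (𝟙-≟-sym (fst u) (snd x)) (𝟙-≟-sym (snd u) (snd x))) ⟩
  occ (fst x) u + occ (snd x) u
    ≡⟨ common-occ x u ⟨
  common x u
    ∎
  where open ≡-Reasoning

common-pair : (a b : Fin n) (a≢b : a ≢ b) (x : V n) → common (pair a b a≢b) x ≡ occ a x + occ b x
common-pair a b a≢b x with a Fin.<? b
... | yes a<b = common-occ ⟨ a , b ∣ a<b ⟩ x
... | no a≮b  = trans (common-occ ⟨ b , a ∣ ≢∧≮⇒> a≢b a≮b ⟩ x) (+-comm (occ b x) (occ a x))

common-by-elements : {p q : Fin n} (u x : V n) → p ≢ q → occ p x ≡ 1 → occ q x ≡ 1 →
                     common u x ≡ occ p u + occ q u
common-by-elements {p = p} {q} u x p≢q p∈x q∈x = begin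
  common u x
    ≡⟨ cong (common u) (≡-by-elements x (pair p q p≢q) p≢q p∈x q∈x
                                        (occ-pairˡ p q p≢q) (occ-pairʳ p q p≢q)) ⟩
  common u (pair p q p≢q)   ≡⟨ common-comm u (pair p q p≢q) ⟩
  common (pair p q p≢q) u   ≡⟨ common-pair p q p≢q u ⟩
  occ p u + occ q u         ∎
  where open ≡-Reasoning

common≤2 : (u x : V n) → common u x ≤ 2
common≤2 u x = subst (_≤ 2) (sym (common-occ u x)) (+-mono-≤ (occ≤1 (fst u) x) (occ≤1 (snd u) x))

common-self : (u : V n) → common u u ≡ 2
common-self u = trans (common-occ u u) (cong₂ _+_ (occ-fst u) (occ-snd u))

common≡2⇒≡ : (u x : V n) → common u x ≡ 2 → u ≡ x
common≡2⇒≡ u x u∩x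
  with +≡2⇒ (occ≤1 (fst u) x) (occ≤1 (snd u) x) (trans (sym (common-occ u x)) u∩x)
  where
  +≡2⇒ : ∀ {i j} → i ≤ 1 → j ≤ 1 → i + j ≡ 2 → i ≡ 1 × j ≡ 1
  +≡2⇒ (s≤s z≤n) (s≤s z≤n) refl = refl , refl
  +≡2⇒ z≤n       (s≤s z≤n) ()
  +≡2⇒ (s≤s z≤n) z≤n       ()
... | fst∈x , snd∈x = ≡-by-elements u x (fst≢snd u) (occ-fst u) (occ-snd u) fst∈x snd∈x

-- Distances and double resolution

Reach-mono : ∀ {a b} {u v : V n} → a ≤ b → Reach a u v → Reach b u v
Reach-mono {b = zero}  z≤n r = r
Reach-mono {b = suc b} a≤1+b r with m≤n⇒m<n∨m≡n a≤1+b
... | inj₁ (s≤s a≤b) = inj₁ (Reach-mono a≤b r)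
... | inj₂ refl      = r

Dist⇒Reach : ∀ k {u v : V n} → Dist u v k → Reach k u v
Dist⇒Reach zero    d = d
Dist⇒Reach (suc k) d = proj₁ d

Dist-functional : ∀ {a b} {u v : V n} → Dist u v a → Dist u v b → a ≡ b
Dist-functional {a = a} {b} da db with <-cmp a b
... | tri≈ _ a≡b _ = a≡b
Dist-functional {a = a} {suc b} da db | tri< a<b _ _ =
  ⊥-elim (proj₂ db (Reach-mono (≤-pred a<b) (Dist⇒Reach a da)))
Dist-functional {a = suc a} {b} da db | tri> _ _ b<a =
  ⊥-elim (proj₂ da (Reach-mono (≤-pred b<a) (Dist⇒Reach b db)))

dist : V n → V n → ℕ
dist u x = 2 ∸ common u x

Dist-dist : (u x : V n) → Dist u x (dist u x)
Dist-dist u x with common u x in u∩x | common≤2 u x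
... | 2 | _ = common≡2⇒≡ u x u∩x
... | 1 | _ = inj₂ (u , refl , u∩x) , u≢x
  where
  u≢x : u ≢ x
  u≢x refl with trans (sym (common-self u)) u∩x
  ... | ()
... | 0 | _ = inj₂ (w , inj₂ (u , refl , u~w) , w~x) , not-within-1
  where
  fst-u∉x : occ (fst u) x ≡ 0
  fst-u∉x = m+n≡0⇒m≡0 _ (trans (sym (common-occ u x)) u∩x)
  fst-x∉u : occ (fst x) u ≡ 0
  fst-x∉u = m+n≡0⇒m≡0 _ (trans (sym (common-occ x u)) (trans (sym (common-comm u x)) u∩x))
  w : V _
  w = pair (fst u) (fst x) (occ-≢ x fst-u∉x (occ-fst x))
  u~w : common u w ≡ 1
  u~w = trans (common-comm u w) (trans (common-pair (fst u) (fst x) _ u) (cong₂ _+_ (occ-fst u) fst-x∉u))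
  w~x : common w x ≡ 1
  w~x = trans (common-pair (fst u) (fst x) _ x) (cong₂ _+_ fst-u∉x (occ-fst x))
  not-within-1 : ¬ Reach 1 u x
  not-within-1 (inj₁ refl) with trans (sym (common-self u)) u∩x
  ... | ()
  not-within-1 (inj₂ (_ , refl , u~x)) with trans (sym u~x) u∩x
  ... | ()
... | suc (suc (suc _)) | s≤s (s≤s ())

∸-difference : ∀ {m c c′} → c ≤ m → c′ ≤ m →
               ℤ.+ (m ∸ c) ℤ.- ℤ.+ (m ∸ c′) ≡ ℤ.+ c′ ℤ.- ℤ.+ c
∸-difference {m} {c} {c′} c≤m c′≤m = begin
  ℤ.+ (m ∸ c) ℤ.- ℤ.+ (m ∸ c′)
    ≡⟨ cong₂ ℤ._-_ (as-difference c≤m) (as-difference c′≤m) ⟩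
  (ℤ.+ m ℤ.- ℤ.+ c) ℤ.- (ℤ.+ m ℤ.- ℤ.+ c′)
    ≡⟨ solve 3 (λ m c c′ → (m :- c) :- (m :- c′) := c′ :- c) refl (ℤ.+ m) (ℤ.+ c) (ℤ.+ c′) ⟩
  ℤ.+ c′ ℤ.- ℤ.+ c
    ∎
  where
  open ≡-Reasoning
  open ℤ-Solver using (_:-_; _:=_; solve)
  as-difference : ∀ {k} → k ≤ m → ℤ.+ (m ∸ k) ≡ ℤ.+ m ℤ.- ℤ.+ k
  as-difference {k} k≤m = trans (sym (ℤₚ.≤-⊖ k≤m)) (sym (ℤₚ.m-n≡m⊖n m k))

-≡-⇔+≡ : ∀ a b c e → (ℤ.+ a ℤ.- ℤ.+ b ≡ ℤ.+ c ℤ.- ℤ.+ e) ⇔ (a + e ≡ c + b)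
-≡-⇔+≡ a b c e = mk⇔ to from
  where
  open ≡-Reasoning
  open ℤ-Solver using (_:+_; _:-_; _:=_; solve)
  to : ℤ.+ a ℤ.- ℤ.+ b ≡ ℤ.+ c ℤ.- ℤ.+ e → a + e ≡ c + b
  to eq = ℤₚ.+-injective (begin
    ℤ.+ (a + e)
      ≡⟨ ℤₚ.pos-+ a e ⟩
    ℤ.+ a ℤ.+ ℤ.+ e
      ≡⟨ solve 3 (λ a b e → a :+ e := (a :- b) :+ (b :+ e)) refl (ℤ.+ a) (ℤ.+ b) (ℤ.+ e) ⟩
    (ℤ.+ a ℤ.- ℤ.+ b) ℤ.+ (ℤ.+ b ℤ.+ ℤ.+ e)
      ≡⟨ cong (ℤ._+ (ℤ.+ b ℤ.+ ℤ.+ e)) eq ⟩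
    (ℤ.+ c ℤ.- ℤ.+ e) ℤ.+ (ℤ.+ b ℤ.+ ℤ.+ e)
      ≡⟨ solve 3 (λ b c e → (c :- e) :+ (b :+ e) := c :+ b) refl (ℤ.+ b) (ℤ.+ c) (ℤ.+ e) ⟩
    ℤ.+ c ℤ.+ ℤ.+ b
      ≡⟨ ℤₚ.pos-+ c b ⟨
    ℤ.+ (c + b)
      ∎)
  from : a + e ≡ c + b → ℤ.+ a ℤ.- ℤ.+ b ≡ ℤ.+ c ℤ.- ℤ.+ e
  from eq = begin
    ℤ.+ a ℤ.- ℤ.+ b
      ≡⟨ solve 3 (λ a b e → a :- b := (a :+ e) :- (b :+ e)) refl (ℤ.+ a) (ℤ.+ b) (ℤ.+ e) ⟩
    (ℤ.+ a ℤ.+ ℤ.+ e) ℤ.- (ℤ.+ b ℤ.+ ℤ.+ e)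
      ≡⟨ cong (ℤ._- (ℤ.+ b ℤ.+ ℤ.+ e)) sums ⟩
    (ℤ.+ c ℤ.+ ℤ.+ b) ℤ.- (ℤ.+ b ℤ.+ ℤ.+ e)
      ≡⟨ solve 3 (λ b c e → (c :+ b) :- (b :+ e) := c :- e) refl (ℤ.+ b) (ℤ.+ c) (ℤ.+ e) ⟩
    ℤ.+ c ℤ.- ℤ.+ e
      ∎
    where
    sums : ℤ.+ a ℤ.+ ℤ.+ e ≡ ℤ.+ c ℤ.+ ℤ.+ b
    sums = trans (sym (ℤₚ.pos-+ a e)) (trans (cong ℤ.+_ eq) (ℤₚ.pos-+ c b))

doublyResolves⇔ : {x y u v : V n} →
                  DoublyResolves x y u v ⇔ (common u y + common v x ≢ common v y + common u x)
doublyResolves⇔ {x = x} {y} {u} {v} = mk⇔ to from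
  where
  difference : (w : V _) → ℤ.+ dist w x ℤ.- ℤ.+ dist w y ≡ ℤ.+ common w y ℤ.- ℤ.+ common w x
  difference w = ∸-difference (common≤2 w x) (common≤2 w y)
  cross : (ℤ.+ common u y ℤ.- ℤ.+ common u x ≡ ℤ.+ common v y ℤ.- ℤ.+ common v x) ⇔
          (common u y + common v x ≡ common v y + common u x)
  cross = -≡-⇔+≡ (common u y) (common u x) (common v y) (common v x)
  to : DoublyResolves x y u v → common u y + common v x ≢ common v y + common u x
  to resolves balanced = resolves _ _ _ _ (Dist-dist u x) (Dist-dist u y) (Dist-dist v x) (Dist-dist v y)
    (trans (difference u) (trans (Equivalence.from cross balanced) (sym (difference v))))
  from : common u y + common v x ≢ common v y + common u x → DoublyResolves x y u v
  from unbalanced a b c e ux uy vx vy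
    rewrite Dist-functional ux (Dist-dist u x) | Dist-functional uy (Dist-dist u y)
          | Dist-functional vx (Dist-dist v x) | Dist-functional vy (Dist-dist v y) =
    λ eq → unbalanced (Equivalence.to cross (trans (sym (difference u)) (trans eq (difference v))))

-- |u ∩ w| − |v ∩ w| = t − s for every w ∈ D, stated without subtraction.
Shifted : List (V n) → V n → V n → Set
Shifted D u v = ∃₂ λ s t → ∀ {w} → w ∈ D → common u w + s ≡ common v w + t

+-cross : ∀ {a b c d s t} → a + s ≡ c + t → b + s ≡ d + t → b + c ≡ d + a
+-cross {a} {b} {c} {d} {s} {t} as≡ct bs≡dt = +-cancelʳ-≡ (s + t) (b + c) (d + a) (begin
  (b + c) + (s + t)   ≡⟨ solve 4 (λ b c s t → (b :+ c) :+ (s :+ t) := (b :+ s) :+ (c :+ t)) refl b c s t ⟩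
  (b + s) + (c + t)   ≡⟨ cong₂ _+_ bs≡dt (sym as≡ct) ⟩
  (d + t) + (a + s)   ≡⟨ solve 4 (λ d t a s → (d :+ t) :+ (a :+ s) := (d :+ a) :+ (s :+ t)) refl d t a s ⟩
  (d + a) + (s + t)   ∎)
  where
  open ≡-Reasoning
  open +-*-Solver using (_:+_; _:=_; solve)

resolving⇔unshifted : {D : List (V n)} → IsDoublyResolving D ⇔ (∀ {u v} → Shifted D u v → u ≡ v)
resolving⇔unshifted {D = D} = mk⇔ to (from D)
  where
  to : IsDoublyResolving D → ∀ {u v} → Shifted D u v → u ≡ v
  to resolving {u} {v} (s , t , shifted) with u ≟ᵥ v
  ... | yes u≡v = u≡v
  ... | no u≢v with resolving u v u≢v
  ...   | x , y , x∈D , y∈D , resolves = ⊥-elim (Equivalence.to doublyResolves⇔ resolves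
          (+-cross {a = common u x} {common u y} {common v x} {common v y} (shifted x∈D) (shifted y∈D)))
  from : ∀ D → (∀ {u v} → Shifted D u v → u ≡ v) → IsDoublyResolving D
  from [] unshifted u v u≢v = ⊥-elim (u≢v (unshifted (0 , 0 , λ ())))
  from D@(x₀ ∷ _) unshifted u v u≢v
    with any? (λ y → ¬? (common u y + common v x₀ ℕ.≟ common v y + common u x₀)) D
  ... | yes unbalanced with find unbalanced
  ...   | y , y∈D , ne = x₀ , y , here refl , y∈D , Equivalence.from doublyResolves⇔ ne
  from D@(x₀ ∷ _) unshifted u v u≢v | no allBalanced =
    ⊥-elim (u≢v (unshifted (common v x₀ , common u x₀ , λ w∈D →
      decidable-stable (_ ℕ.≟ _) (λ ne → allBalanced (lose w∈D ne)))))

module Degrees {n : ℕ} (D : List (V n)) (D! : Unique D) where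

  deg : Fin n → ℕ
  deg a = ∑[ x ∈ D ] occ a x

  ∑-weighted-deg : (f : Fin n → ℕ) →
                   ∑[ a ∈ allFin n ] (f a * deg a) ≡ ∑[ x ∈ D ] (f (fst x) + f (snd x))
  ∑-weighted-deg f = begin
    ∑[ a ∈ allFin n ] (f a * deg a)
      ≡⟨ ∑-cong (allFin n) (λ {a} _ → *-distribˡ-∑ (f a) D (occ a)) ⟩
    ∑[ a ∈ allFin n ] ∑[ x ∈ D ] (f a * occ a x)
      ≡⟨ ∑-comm (allFin n) D (λ a x → f a * occ a x) ⟩
    ∑[ x ∈ D ] ∑[ a ∈ allFin n ] (f a * occ a x)
      ≡⟨ ∑-cong D (λ {x} _ → endpoints x) ⟩
    ∑[ x ∈ D ] (f (fst x) + f (snd x))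
      ∎
    where
    open ≡-Reasoning
    endpoints : (x : V n) → ∑[ a ∈ allFin n ] (f a * occ a x) ≡ f (fst x) + f (snd x)
    endpoints x = begin
      ∑[ a ∈ allFin n ] (f a * occ a x)
        ≡⟨ ∑-cong (allFin n) (λ {a} _ → *-distribˡ-+ (f a) (𝟙 (a ≟ fst x)) (𝟙 (a ≟ snd x))) ⟩
      ∑[ a ∈ allFin n ] (f a * 𝟙 (a ≟ fst x) + f a * 𝟙 (a ≟ snd x))
        ≡⟨ ∑-distrib-+ (allFin n) (λ a → f a * 𝟙 (a ≟ fst x)) (λ a → f a * 𝟙 (a ≟ snd x)) ⟩
      ∑[ a ∈ allFin n ] (f a * 𝟙 (a ≟ fst x)) + ∑[ a ∈ allFin n ] (f a * 𝟙 (a ≟ snd x))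
        ≡⟨ cong₂ _+_ (∑-select f (fst x)) (∑-select f (snd x)) ⟩
      f (fst x) + f (snd x)
        ∎

  deg≥1 : (a : Fin n) {x : V n} → x ∈ D → occ a x ≡ 1 → 1 ≤ deg a
  deg≥1 a x∈D a∈x = subst (_≤ deg a) a∈x (f≤∑ (occ a) x∈D)

  deg-distinct : {a b : Fin n} {i j : ℕ} → deg a ≡ i → deg b ≡ j → i ≢ j → a ≢ b
  deg-distinct a-deg b-deg i≢j refl = i≢j (trans (sym a-deg) b-deg)

  occ-isolated : (a : Fin n) {w : V n} → deg a ≡ 0 → w ∈ D → occ a w ≡ 0
  occ-isolated a {w} a-isolated w∈D = n≤0⇒n≡0 (subst (occ a w ≤_) a-isolated (f≤∑ (occ a) w∈D))

  occ-leaf : (a : Fin n) {x w : V n} → deg a ≡ 1 → x ∈ D → occ a x ≡ 1 →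
             w ∈ D → occ a w ≡ 𝟙 (w ≟ᵥ x)
  occ-leaf a {x} {w} a-leaf x∈D a∈x w∈D with w ≟ᵥ x
  ... | yes refl = a∈x
  ... | no w≢x   = n≤0⇒n≡0 (+-cancelˡ-≤ 1 (occ a w) 0
                     (subst₂ (λ i j → i + occ a w ≤ j) a∈x a-leaf (f+f≤∑ (occ a) x∈D w∈D w≢x)))

  occ-deg2 : (a : Fin n) {x y w : V n} → deg a ≡ 2 → x ∈ D → y ∈ D → y ≢ x →
             occ a x ≡ 1 → occ a y ≡ 1 → w ∈ D → occ a w ≡ 𝟙 (w ≟ᵥ x) + 𝟙 (w ≟ᵥ y)
  occ-deg2 a {x} {y} {w} a-deg2 x∈D y∈D y≢x a∈x a∈y w∈D with w ≟ᵥ x | w ≟ᵥ y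
  ... | yes refl | yes refl = ⊥-elim (y≢x refl)
  ... | yes refl | no _     = a∈x
  ... | no _     | yes refl = a∈y
  ... | no w≢x   | no w≢y   = n≤0⇒n≡0 (+-cancelˡ-≤ 2 (occ a w) 0
                               (subst₂ (λ i j → i + occ a w ≤ j) (cong₂ _+_ a∈x a∈y) a-deg2
                                       (f+f+f≤∑ (occ a) x∈D y∈D w∈D y≢x w≢x w≢y)))

  edge-at : (a : Fin n) → 0 < deg a → ∃ λ x → x ∈ D × occ a x ≡ 1
  edge-at a 0<deg with ∑>0⇒∃ D (occ a) 0<deg
  ... | x , x∈D , 0<occ = x , x∈D , occ>0⇒≡1 a x 0<occ

  another-edge-at : (a : Fin n) {x : V n} → deg a ≡ 2 → x ∈ D → occ a x ≡ 1 →
                    ∃ λ y → y ∈ D × y ≢ x × occ a y ≡ 1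
  another-edge-at a {x} a-deg2 x∈D a∈x
    with f<∑⇒∃ (occ a) D! x∈D (subst₂ _<_ (sym a∈x) (sym a-deg2) ≤-refl)
  ... | y , y∈D , y≢x , 0<occ = y , y∈D , y≢x , occ>0⇒≡1 a y 0<occ

  #isolated excess : ℕ
  #isolated = ∑[ a ∈ allFin n ] 𝟙 (deg a ℕ.≟ 0)
  excess    = ∑[ a ∈ allFin n ] (deg a ∸ 2)

  leafEnds : V n → ℕ
  leafEnds x = 𝟙 (deg (fst x) ℕ.≟ 1) + 𝟙 (deg (snd x) ℕ.≟ 1)

  degree-count : 2 * length D + 2 * #isolated + ∑ D leafEnds ≡ 2 * n + excess
  degree-count = begin
    2 * length D + 2 * #isolated + ∑ D leafEnds
      ≡⟨ cong₂ _+_ (cong₂ _+_ handshake (*-distribˡ-∑ 2 (allFin n) isolated)) leaves ⟩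
    ∑ (allFin n) deg + ∑[ a ∈ allFin n ] (2 * isolated a) + ∑ (allFin n) leaf
      ≡⟨ cong (_+ ∑ (allFin n) leaf) (∑-distrib-+ (allFin n) deg (λ a → 2 * isolated a)) ⟨
    ∑[ a ∈ allFin n ] (deg a + 2 * isolated a) + ∑ (allFin n) leaf
      ≡⟨ ∑-distrib-+ (allFin n) (λ a → deg a + 2 * isolated a) leaf ⟨
    ∑[ a ∈ allFin n ] (deg a + 2 * isolated a + leaf a)
      ≡⟨ ∑-cong (allFin n) (λ {a} _ → local-count (deg a)) ⟩
    ∑[ a ∈ allFin n ] (2 + (deg a ∸ 2))
      ≡⟨ ∑-distrib-+ (allFin n) (λ _ → 2) (λ a → deg a ∸ 2) ⟩
    ∑[ a ∈ allFin n ] 2 + excess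
      ≡⟨ cong (_+ excess) (trans (∑-const (allFin n) 2) (cong (_* 2) (length-tabulate {n = n} id))) ⟩
    n * 2 + excess
      ≡⟨ cong (_+ excess) (*-comm n 2) ⟩
    2 * n + excess
      ∎
    where
    open ≡-Reasoning
    isolated leaf : Fin n → ℕ
    isolated a = 𝟙 (deg a ℕ.≟ 0)
    leaf a     = 𝟙 (deg a ℕ.≟ 1)
    local-count : ∀ k → k + 2 * 𝟙 (k ℕ.≟ 0) + 𝟙 (k ℕ.≟ 1) ≡ 2 + (k ∸ 2)
    local-count 0             = refl
    local-count 1             = refl
    local-count (suc (suc k)) = trans (+-identityʳ _) (+-identityʳ _)
    leaf-weight : ∀ k → 𝟙 (k ℕ.≟ 1) * k ≡ 𝟙 (k ℕ.≟ 1)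
    leaf-weight 0             = refl
    leaf-weight 1             = refl
    leaf-weight (suc (suc k)) = refl
    handshake : 2 * length D ≡ ∑ (allFin n) deg
    handshake = sym (begin
      ∑ (allFin n) deg                ≡⟨ ∑-cong (allFin n) (λ {a} _ → sym (*-identityˡ (deg a))) ⟩
      ∑[ a ∈ allFin n ] (1 * deg a)   ≡⟨ ∑-weighted-deg (λ _ → 1) ⟩
      ∑[ x ∈ D ] 2                    ≡⟨ ∑-const D 2 ⟩
      length D * 2                    ≡⟨ *-comm (length D) 2 ⟩
      2 * length D                    ∎)
    leaves : ∑ D leafEnds ≡ ∑ (allFin n) leaf
    leaves = sym (trans (∑-cong (allFin n) (λ {a} _ → sym (leaf-weight (deg a)))) (∑-weighted-deg leaf))

-- The lower bound

fresh : 3 ≤ n → (p q : Fin n) → ∃ λ r → r ≢ p × r ≢ q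
fresh (s≤s (s≤s (s≤s _))) p q with Fin.zero ≟ p | Fin.zero ≟ q
... | no 0≢p   | no 0≢q = Fin.zero , 0≢p , 0≢q
... | yes refl | _ with Fin.suc Fin.zero ≟ q
...   | no 1≢q   = Fin.suc Fin.zero , (λ ()) , 1≢q
...   | yes refl = Fin.suc (Fin.suc Fin.zero) , (λ ()) , (λ ())
fresh (s≤s (s≤s (s≤s _))) p q | no _ | yes refl with Fin.suc Fin.zero ≟ p
...   | no 1≢p   = Fin.suc Fin.zero , 1≢p , (λ ())
...   | yes refl = Fin.suc (Fin.suc Fin.zero) , (λ ()) , (λ ())

module Resolving {n : ℕ} (3≤n : 3 ≤ n) (D : List (V n)) (D! : Unique D)
                 (unshifted : ∀ {u v} → Shifted D u v → u ≡ v) where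

  open Degrees D D!

  balanced-pairs⇒ : (a b c d : Fin n) (a≢b : a ≢ b) (c≢d : c ≢ d) →
                    (∀ {w} → w ∈ D → occ a w + occ b w ≡ occ c w + occ d w) → a ≡ c ⊎ a ≡ d
  balanced-pairs⇒ a b c d a≢b c≢d balanced =
    pair-≡⇒ (unshifted {pair a b a≢b} {pair c d c≢d} (0 , 0 , λ {w} w∈D → cong (_+ 0) (begin
      common (pair a b a≢b) w   ≡⟨ common-pair a b a≢b w ⟩
      occ a w + occ b w         ≡⟨ balanced w∈D ⟩
      occ c w + occ d w         ≡⟨ common-pair c d c≢d w ⟨
      common (pair c d c≢d) w   ∎)))
    where open ≡-Reasoning

  -- Compare the vertices {a, r} and {b, r} for a third point r.
  shifted-points⇒≡ : {a b : Fin n} {s t : ℕ} →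
                     (∀ {w} → w ∈ D → occ a w + s ≡ occ b w + t) → a ≡ b
  shifted-points⇒≡ {a} {b} {s} {t} shifted with fresh 3≤n a b
  ... | r , r≢a , r≢b
    with pair-≡⇒ (unshifted {pair a r (r≢a ∘ sym)} {pair b r (r≢b ∘ sym)} (s , t , profile))
    where
    profile : ∀ {w} → w ∈ D →
              common (pair a r (r≢a ∘ sym)) w + s ≡ common (pair b r (r≢b ∘ sym)) w + t
    profile {w} w∈D = begin
      common (pair a r _) w + s   ≡⟨ cong (_+ s) (common-pair a r _ w) ⟩
      occ a w + occ r w + s       ≡⟨ xy∙z≈xz∙y (occ a w) (occ r w) s ⟩
      occ a w + s + occ r w       ≡⟨ cong (_+ occ r w) (shifted w∈D) ⟩
      occ b w + t + occ r w       ≡⟨ xy∙z≈xz∙y (occ b w) t (occ r w) ⟩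
      occ b w + occ r w + t       ≡⟨ cong (_+ t) (common-pair b r _ w) ⟨
      common (pair b r _) w + t   ∎
      where open ≡-Reasoning
  ... | inj₁ a≡b = a≡b
  ... | inj₂ a≡r = ⊥-elim (r≢a (sym a≡r))

  isolated-unique : {a b : Fin n} → deg a ≡ 0 → deg b ≡ 0 → a ≡ b
  isolated-unique {a} {b} a-isolated b-isolated = shifted-points⇒≡ {s = 0} {t = 0} (λ w∈D →
    cong (_+ 0) (trans (occ-isolated a a-isolated w∈D) (sym (occ-isolated b b-isolated w∈D))))

  leafEnds≤1 : {x : V n} → x ∈ D → leafEnds x ≤ 1
  leafEnds≤1 {x} x∈D with deg (fst x) ℕ.≟ 1 | deg (snd x) ℕ.≟ 1
  ... | yes fst-leaf | yes snd-leaf = ⊥-elim (fst≢snd x (shifted-points⇒≡ {s = 0} {t = 0} (λ w∈D →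
    cong (_+ 0) (trans (occ-leaf (fst x) fst-leaf x∈D (occ-fst x) w∈D)
                       (sym (occ-leaf (snd x) snd-leaf x∈D (occ-snd x) w∈D))))))
  ... | yes _ | no _  = ≤-refl
  ... | no _  | yes _ = ≤-refl
  ... | no _  | no _  = z≤n

  leaf-end : (x : V n) → 1 ≤ leafEnds x → ∃ λ a → deg a ≡ 1 × occ a x ≡ 1
  leaf-end x has-leaf with deg (fst x) ℕ.≟ 1 | deg (snd x) ℕ.≟ 1
  ... | yes fst-leaf | _            = fst x , fst-leaf , occ-fst x
  ... | no _         | yes snd-leaf = snd x , snd-leaf , occ-snd x
  leaf-end x () | no _ | no _

  nonleaf-end : {x : V n} → x ∈ D → ∃ λ h → deg h ≢ 1 × occ h x ≡ 1
  nonleaf-end {x} x∈D with deg (fst x) ℕ.≟ 1 | deg (snd x) ℕ.≟ 1 | leafEnds≤1 x∈D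
  ... | no fst-nonleaf | _              | _ = fst x , fst-nonleaf , occ-fst x
  ... | yes _          | no snd-nonleaf | _ = snd x , snd-nonleaf , occ-snd x
  ... | yes _          | yes _          | s≤s ()

  #leafless : ℕ
  #leafless = ∑[ x ∈ D ] (1 ∸ leafEnds x)

  counting : 3 * length D + 2 * #isolated ≡ 2 * n + (excess + #leafless)
  counting = begin
    3 * length D + 2 * #isolated
      ≡⟨ solve 2 (λ m i → con 3 :* m :+ con 2 :* i := con 2 :* m :+ con 2 :* i :+ m)
               refl (length D) #isolated ⟩
    2 * length D + 2 * #isolated + length D
      ≡⟨ cong (2 * length D + 2 * #isolated +_) leaf-split ⟨
    2 * length D + 2 * #isolated + (∑ D leafEnds + #leafless)
      ≡⟨ +-assoc (2 * length D + 2 * #isolated) (∑ D leafEnds) #leafless ⟨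
    2 * length D + 2 * #isolated + ∑ D leafEnds + #leafless
      ≡⟨ cong (_+ #leafless) degree-count ⟩
    2 * n + excess + #leafless
      ≡⟨ +-assoc (2 * n) excess #leafless ⟩
    2 * n + (excess + #leafless)
      ∎
    where
    open ≡-Reasoning
    open +-*-Solver using (solve; _:+_; _:*_; _:=_; con)
    leaf-split : ∑ D leafEnds + #leafless ≡ length D
    leaf-split = begin
      ∑ D leafEnds + #leafless
        ≡⟨ ∑-distrib-+ D leafEnds (λ x → 1 ∸ leafEnds x) ⟨
      ∑[ x ∈ D ] (leafEnds x + (1 ∸ leafEnds x))
        ≡⟨ ∑-cong D (λ x∈D → m+[n∸m]≡n (leafEnds≤1 x∈D)) ⟩
      ∑[ x ∈ D ] 1
        ≡⟨ ∑-const D 1 ⟩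
      length D * 1
        ≡⟨ *-identityʳ (length D) ⟩
      length D
        ∎

  isolated∧P₃⇒⊥ : (e a b d : Fin n) {x y : V n} →
                  deg e ≡ 0 → deg a ≡ 1 → deg b ≡ 2 → deg d ≡ 1 → x ∈ D → y ∈ D → y ≢ x →
                  occ a x ≡ 1 → occ b x ≡ 1 → occ b y ≡ 1 → occ d y ≡ 1 → ⊥
  isolated∧P₃⇒⊥ e a b d {x} {y} e-isolated a-leaf b-deg2 d-leaf x∈D y∈D y≢x a∈x b∈x b∈y d∈y
    with balanced-pairs⇒ e b a d (deg-distinct e-isolated b-deg2 (λ ())) a≢d balanced
    where
    a≢d : a ≢ d
    a≢d = occ-≢ y (trans (occ-leaf a a-leaf x∈D a∈x y∈D) (𝟙-no (y ≟ᵥ x) y≢x)) d∈y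
    balanced : ∀ {w} → w ∈ D → occ e w + occ b w ≡ occ a w + occ d w
    balanced w∈D =
      trans (cong₂ _+_ (occ-isolated e e-isolated w∈D) (occ-deg2 b b-deg2 x∈D y∈D y≢x b∈x b∈y w∈D))
            (sym (cong₂ _+_ (occ-leaf a a-leaf x∈D a∈x w∈D) (occ-leaf d d-leaf y∈D d∈y w∈D)))
  ... | inj₁ e≡a = deg-distinct e-isolated a-leaf (λ ()) e≡a
  ... | inj₂ e≡d = deg-distinct e-isolated d-leaf (λ ()) e≡d

  isolated∧star⇒⊥ : (e c : Fin n) → deg e ≡ 0 → 0 < deg c →
                    (∀ {w} → w ∈ D → occ c w ≡ 1) → ⊥
  isolated∧star⇒⊥ e c e-isolated 0<deg c∈all = <-irrefl (sym (trans (cong deg c≡e) e-isolated)) 0<deg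
    where
    c≡e : c ≡ e
    c≡e = shifted-points⇒≡ {s = 0} {t = 1} (λ w∈D →
      trans (cong (_+ 0) (c∈all w∈D)) (cong (_+ 1) (sym (occ-isolated e e-isolated w∈D))))

  P₄⇒⊥ : (a b c d : Fin n) {x y z : V n} →
         deg a ≡ 1 → deg b ≡ 2 → deg c ≡ 2 → deg d ≡ 1 → b ≢ c →
         x ∈ D → y ∈ D → z ∈ D → y ≢ x → z ≢ x →
         occ b x ≡ 1 → occ c x ≡ 1 → occ a y ≡ 1 → occ b y ≡ 1 → occ c z ≡ 1 → occ d z ≡ 1 → ⊥
  P₄⇒⊥ a b c d {x} {y} {z} a-leaf b-deg2 c-deg2 d-leaf b≢c x∈D y∈D z∈D y≢x z≢x
       b∈x c∈x a∈y b∈y c∈z d∈z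
    with balanced-pairs⇒ c a b d (deg-distinct c-deg2 a-leaf (λ ())) (deg-distinct b-deg2 d-leaf (λ ()))
                         balanced
    where
    balanced : ∀ {w} → w ∈ D → occ c w + occ a w ≡ occ b w + occ d w
    balanced {w} w∈D = begin
      occ c w + occ a w
        ≡⟨ cong₂ _+_ (occ-deg2 c c-deg2 x∈D z∈D z≢x c∈x c∈z w∈D) (occ-leaf a a-leaf y∈D a∈y w∈D) ⟩
      𝟙 (w ≟ᵥ x) + 𝟙 (w ≟ᵥ z) + 𝟙 (w ≟ᵥ y)
        ≡⟨ xy∙z≈xz∙y (𝟙 (w ≟ᵥ x)) (𝟙 (w ≟ᵥ z)) (𝟙 (w ≟ᵥ y)) ⟩
      𝟙 (w ≟ᵥ x) + 𝟙 (w ≟ᵥ y) + 𝟙 (w ≟ᵥ z)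
        ≡⟨ cong₂ _+_ (occ-deg2 b b-deg2 x∈D y∈D y≢x b∈x b∈y w∈D) (occ-leaf d d-leaf z∈D d∈z w∈D) ⟨
      occ b w + occ d w
        ∎
      where open ≡-Reasoning
  ... | inj₁ c≡b = b≢c (sym c≡b)
  ... | inj₂ c≡d = deg-distinct c-deg2 d-leaf (λ ()) c≡d

  endpoints-deg2 : {x : V n} → excess ≡ 0 → x ∈ D → leafEnds x ≡ 0 →
                   deg (fst x) ≡ 2 × deg (snd x) ≡ 2
  endpoints-deg2 {x} no-excess x∈D no-leaf-end = deg≡2 (fst x) (occ-fst x) (m+n≡0⇒m≡0 _ no-leaf-end) ,
                                                 deg≡2 (snd x) (occ-snd x) (m+n≡0⇒n≡0 _ no-leaf-end)
    where
    between-1-and-2 : ∀ {k} → 1 ≤ k → k ≤ 2 → k ≢ 1 → k ≡ 2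
    between-1-and-2 _ (s≤s z≤n)       k≢1 = ⊥-elim (k≢1 refl)
    between-1-and-2 _ (s≤s (s≤s z≤n)) _   = refl
    deg≡2 : ∀ a → occ a x ≡ 1 → 𝟙 (deg a ℕ.≟ 1) ≡ 0 → deg a ≡ 2
    deg≡2 a a∈x not-leaf = between-1-and-2 (deg≥1 a x∈D a∈x) deg≤2 (𝟙≡0⇒¬ (deg a ℕ.≟ 1) not-leaf)
      where
      deg≤2 : deg a ≤ 2
      deg≤2 = m∸n≡0⇒m≤n (n≤0⇒n≡0 (subst (deg a ∸ 2 ≤_) no-excess (f≤∑ (λ a → deg a ∸ 2) (∈-allFin a))))

  single-leafless-edge⇒⊥ : {x : V n} → excess ≡ 0 → x ∈ D → leafEnds x ≡ 0 →
                           (∀ {y} → y ∈ D → y ≢ x → 1 ≤ leafEnds y) → ⊥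
  single-leafless-edge⇒⊥ {x} no-excess x∈D no-leaf-end others-have-leaf-ends
    with endpoints-deg2 no-excess x∈D no-leaf-end
  ... | b-deg2 , c-deg2
    with another-edge-at (fst x) b-deg2 x∈D (occ-fst x) | another-edge-at (snd x) c-deg2 x∈D (occ-snd x)
  ... | y , y∈D , y≢x , b∈y | z , z∈D , z≢x , c∈z
    with leaf-end y (others-have-leaf-ends y∈D y≢x) | leaf-end z (others-have-leaf-ends z∈D z≢x)
  ... | a , a-leaf , a∈y | d , d-leaf , d∈z =
    P₄⇒⊥ a (fst x) (snd x) d a-leaf b-deg2 c-deg2 d-leaf (fst≢snd x) x∈D y∈D z∈D y≢x z≢x
         (occ-fst x) (occ-snd x) a∈y b∈y c∈z d∈z

  leafless≡1⇒excess≢0 : #leafless ≡ 1 → excess ≢ 0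
  leafless≡1⇒excess≢0 one-leafless no-excess
    with ∑>0⇒∃ D (λ x → 1 ∸ leafEnds x) (subst (0 <_) (sym one-leafless) z<s)
  ... | x , x∈D , 0<1∸leafEnds = single-leafless-edge⇒⊥ no-excess x∈D no-leaf-end others-have-leaf-ends
    where
    1∸k>0⇒k≡0 : ∀ k → 0 < 1 ∸ k → k ≡ 0
    1∸k>0⇒k≡0 0             _  = refl
    1∸k>0⇒k≡0 (suc zero)    ()
    1∸k>0⇒k≡0 (suc (suc _)) ()
    no-leaf-end : leafEnds x ≡ 0
    no-leaf-end = 1∸k>0⇒k≡0 (leafEnds x) 0<1∸leafEnds
    others-have-leaf-ends : ∀ {y} → y ∈ D → y ≢ x → 1 ≤ leafEnds y
    others-have-leaf-ends {y} y∈D y≢x = m∸n≡0⇒m≤n (n≤0⇒n≡0 (+-cancelˡ-≤ 1 _ 0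
      (subst₂ (λ i j → i + (1 ∸ leafEnds y) ≤ j) (cong (1 ∸_) no-leaf-end) one-leafless
              (f+f≤∑ (λ x → 1 ∸ leafEnds x) x∈D y∈D y≢x))))

  excess<2⇒big-unique : excess < 2 → (a b : Fin n) → 3 ≤ deg a → 3 ≤ deg b → a ≡ b
  excess<2⇒big-unique excess<2 a b 3≤a 3≤b with a ≟ b
  ... | yes a≡b = a≡b
  ... | no a≢b  = ⊥-elim (<⇒≱ excess<2 (begin
    2                           ≤⟨ +-mono-≤ (∸-monoˡ-≤ 2 3≤a) (∸-monoˡ-≤ 2 3≤b) ⟩
    (deg a ∸ 2) + (deg b ∸ 2)   ≤⟨ f+f≤∑ (λ k → deg k ∸ 2) (∈-allFin a) (∈-allFin b) (a≢b ∘ sym) ⟩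
    excess                      ∎))
    where open ≤-Reasoning

  module _ (e : Fin n) (e-isolated : deg e ≡ 0) (no-leafless : #leafless ≡ 0) where

    has-leaf-end : ∀ {x} → x ∈ D → 1 ≤ leafEnds x
    has-leaf-end {x} x∈D = m∸n≡0⇒m≤n (n≤0⇒n≡0
      (subst (1 ∸ leafEnds x ≤_) no-leafless (f≤∑ (λ x → 1 ∸ leafEnds x) x∈D)))

    deg≢2 : (b : Fin n) → deg b ≢ 2
    deg≢2 b b-deg2 with edge-at b (subst (0 <_) (sym b-deg2) z<s)
    ... | x , x∈D , b∈x with another-edge-at b b-deg2 x∈D b∈x
    ... | y , y∈D , y≢x , b∈y with leaf-end x (has-leaf-end x∈D) | leaf-end y (has-leaf-end y∈D)
    ... | a , a-leaf , a∈x | d , d-leaf , d∈y =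
      isolated∧P₃⇒⊥ e a b d e-isolated a-leaf b-deg2 d-leaf x∈D y∈D y≢x a∈x b∈x b∈y d∈y

    hub : {x : V n} → x ∈ D → ∃ λ h → 3 ≤ deg h × occ h x ≡ 1
    hub x∈D with nonleaf-end x∈D
    ... | h , h-nonleaf , h∈x = h , above-2 (deg≥1 h x∈D h∈x) h-nonleaf (deg≢2 h) , h∈x
      where
      above-2 : ∀ {k} → 1 ≤ k → k ≢ 1 → k ≢ 2 → 3 ≤ k
      above-2 {1}                 _ k≢1 _   = ⊥-elim (k≢1 refl)
      above-2 {2}                 _ _   k≢2 = ⊥-elim (k≢2 refl)
      above-2 {suc (suc (suc _))} _ _   _   = s≤s (s≤s (s≤s z≤n))

    some-hub : ∃ λ c → 3 ≤ deg c
    some-hub =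
      let r , r≢e , _     = fresh 3≤n e e
          x₀ , x₀∈D , _   = edge-at r (n≢0⇒n>0 (r≢e ∘ flip isolated-unique e-isolated))
          c , 3≤deg-c , _ = hub x₀∈D
      in c , 3≤deg-c

    excess≥2 : 2 ≤ excess
    excess≥2 = ≮⇒≥ λ excess<2 →
      let c , 3≤deg-c = some-hub
          c∈all : ∀ {w} → w ∈ D → occ c w ≡ 1
          c∈all {w} w∈D =
            let h , 3≤deg-h , h∈w = hub w∈D
            in subst (λ k → occ k w ≡ 1) (excess<2⇒big-unique excess<2 h c 3≤deg-h 3≤deg-c) h∈w
      in isolated∧star⇒⊥ e c e-isolated (≤-trans (s≤s z≤n) 3≤deg-c) c∈all

  isolated⇒2≤excess+leafless : (e : Fin n) → deg e ≡ 0 → 2 ≤ excess + #leafless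
  isolated⇒2≤excess+leafless e e-isolated with #leafless in leafless
  ... | 0           = subst (2 ≤_) (sym (+-identityʳ excess)) (excess≥2 e e-isolated leafless)
  ... | 1           = +-monoˡ-≤ 1 (n≢0⇒n>0 (leafless≡1⇒excess≢0 leafless))
  ... | suc (suc k) = ≤-trans (s≤s (s≤s z≤n)) (m≤n+m (suc (suc k)) excess)

  2*isolated≤excess+leafless : 2 * #isolated ≤ excess + #leafless
  2*isolated≤excess+leafless with Finₚ.any? (λ a → deg a ℕ.≟ 0)
  ... | yes (e , e-isolated) =
    subst (λ k → 2 * k ≤ excess + #leafless) (sym one-isolated) (isolated⇒2≤excess+leafless e e-isolated)
    where
    one-isolated : #isolated ≡ 1
    one-isolated = trans (∑-supported (λ a → 𝟙 (deg a ℕ.≟ 0)) (Uniqueₚ.allFin⁺ n) (∈-allFin e) vanishes)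
                         (𝟙-yes (deg e ℕ.≟ 0) e-isolated)
      where
      vanishes : ∀ {a} → a ∈ allFin n → a ≢ e → 𝟙 (deg a ℕ.≟ 0) ≡ 0
      vanishes {a} _ a≢e = 𝟙-no (deg a ℕ.≟ 0) (a≢e ∘ flip isolated-unique e-isolated)
  ... | no none = subst (λ k → 2 * k ≤ excess + #leafless) (sym no-isolated) z≤n
    where
    no-isolated : #isolated ≡ 0
    no-isolated = ∑-zero {xs = allFin n} (λ {a} _ → 𝟙-no (deg a ℕ.≟ 0) (none ∘ (a ,_)))

  lower-bound : 2 * n ≤ 3 * length D
  lower-bound = +-cancelʳ-≤ (2 * #isolated) (2 * n) (3 * length D) (begin
    2 * n + 2 * #isolated          ≤⟨ +-monoʳ-≤ (2 * n) 2*isolated≤excess+leafless ⟩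
    2 * n + (excess + #leafless)   ≡⟨ counting ⟨
    3 * length D + 2 * #isolated   ∎)
    where open ≤-Reasoning

-- Spanning star forests are doubly resolving

record StarForest (D : List (V n)) : Set where
  field
    centre      : Fin n → Fin n
    centre-idem : ∀ a → centre (centre a) ≡ centre a
    two-leaves  : ∀ c → centre c ≡ c →
                  ∃₂ λ l l′ → l ≢ l′ × (centre l ≡ c × l ≢ c) × (centre l′ ≡ c × l′ ≢ c)
    star-edge   : ∀ l → centre l ≢ l → ∃ λ x → x ∈ D × occ l x ≡ 1 × occ (centre l) x ≡ 1

module _ {D : List (V n)} (F : StarForest D) where

  open StarForest F

  Balanced : V n → V n → Set
  Balanced u v = ∀ l → centre l ≢ l → occ l u + occ (centre l) u ≡ occ l v + occ (centre l) v

  private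
    suc≡⇒ : ∀ {i j} → j ≤ 1 → suc i ≡ j → i ≡ 0 × j ≡ 1
    suc≡⇒ (s≤s z≤n) refl = refl , refl

  module _ (u v : V n) (balanced : Balanced u v) where

    leaf-pushes : ∀ l → centre l ≢ l → occ l u ≡ 1 → occ l v ≡ 0 →
                  occ (centre l) u ≡ 0 × occ (centre l) v ≡ 1
    leaf-pushes l l-leaf lu lv = suc≡⇒ (occ≤1 (centre l) v)
      (trans (cong (_+ occ (centre l) u) (sym lu)) (trans (balanced l l-leaf) (cong (_+ occ (centre l) v) lv)))

    centre-pushes : ∀ c → occ c u ≡ 1 → occ c v ≡ 0 → ∀ l → centre l ≡ c → l ≢ c →
                    occ l u ≡ 0 × occ l v ≡ 1
    centre-pushes c cu cv l cl l≢c = suc≡⇒ (occ≤1 l v) (begin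
      suc (occ l u)                ≡⟨ +-comm 1 (occ l u) ⟩
      occ l u + 1                  ≡⟨ cong (occ l u +_) (trans (sym cu) (cong (λ k → occ k u) (sym cl))) ⟩
      occ l u + occ (centre l) u   ≡⟨ balanced l (λ eq → l≢c (trans (sym eq) cl)) ⟩
      occ l v + occ (centre l) v   ≡⟨ cong (occ l v +_) (trans (cong (λ k → occ k v) cl) cv) ⟩
      occ l v + 0                  ≡⟨ +-identityʳ (occ l v) ⟩
      occ l v                      ∎)
      where open ≡-Reasoning

    centre∈u∖v⇒⊥ : ∀ c → centre c ≡ c → occ c u ≡ 1 → occ c v ≡ 0 → ⊥
    centre∈u∖v⇒⊥ c c-centre cu cv with two-leaves c c-centre | other-element u cu
    ... | l , l′ , l≢l′ , (cl , l≢c) , (cl′ , l′≢c) | y , y≢c , yu = y-star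
      where
      v⊆leaves : ∀ {p} → occ p v ≡ 1 → (centre p ≡ c × p ≢ c) × occ p u ≡ 0
      v⊆leaves {p} pv with only-two-elements {a = p} v l≢l′ (proj₂ (centre-pushes c cu cv l cl l≢c))
                                                          (proj₂ (centre-pushes c cu cv l′ cl′ l′≢c)) pv
      ... | inj₁ refl = (cl , l≢c) , proj₁ (centre-pushes c cu cv l cl l≢c)
      ... | inj₂ refl = (cl′ , l′≢c) , proj₁ (centre-pushes c cu cv l′ cl′ l′≢c)
      yv : occ y v ≡ 0
      yv with n≤1⇒n≡0∨n≡1 (occ≤1 y v)
      ... | inj₁ y∉v = y∉v
      ... | inj₂ y∈v with trans (sym yu) (proj₂ (v⊆leaves {y} y∈v))
      ...   | ()
      y-star : ⊥
      y-star with centre y ≟ y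
      ... | yes y-centre with two-leaves y y-centre
      ...   | m , _ , _ , (cm , m≢y) , _ =
        y≢c (trans (sym cm) (proj₁ (proj₁ (v⊆leaves (proj₂ (centre-pushes y yu yv m cm m≢y))))))
      y-star | no y-leaf with v⊆leaves (proj₂ (leaf-pushes y y-leaf yu yv))
      ... | (ccy , cy≢c) , _ = cy≢c (trans (sym (centre-idem y)) ccy)

  balanced⇒≡ : {u v : V n} → Balanced u v → u ≡ v
  balanced⇒≡ {u} {v} balanced with u ≟ᵥ v
  ... | yes u≡v = u≡v
  ... | no u≢v with ∃-difference u≢v
  ...   | z , zu , zv with centre z ≟ z
  ...     | yes z-centre = ⊥-elim (centre∈u∖v⇒⊥ u v balanced z z-centre zu zv)
  ...     | no z-leaf    = ⊥-elim (centre∈u∖v⇒⊥ v u (λ l l-leaf → sym (balanced l l-leaf))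
                                     (centre z) (centre-idem z) (proj₂ pushed) (proj₁ pushed))
    where
    pushed : occ (centre z) u ≡ 0 × occ (centre z) v ≡ 1
    pushed = leaf-pushes u v balanced z z-leaf zu zv

  module _ (u v : V n) (s t : ℕ) (shifted : ∀ {w} → w ∈ D → common u w + s ≡ common v w + t) where

    edge-shift : ∀ l → centre l ≢ l → occ l u + occ (centre l) u + s ≡ occ l v + occ (centre l) v + t
    edge-shift l l-leaf with star-edge l l-leaf
    ... | x , x∈D , l∈x , cl∈x = begin
      occ l u + occ (centre l) u + s   ≡⟨ cong (_+ s) (common-by-elements u x l≢cl l∈x cl∈x) ⟨
      common u x + s                   ≡⟨ shifted x∈D ⟩
      common v x + t                   ≡⟨ cong (_+ t) (common-by-elements v x l≢cl l∈x cl∈x) ⟩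
      occ l v + occ (centre l) v + t   ∎
      where
      open ≡-Reasoning
      l≢cl : l ≢ centre l
      l≢cl = l-leaf ∘ sym

    on-star-edge : ∀ z → ∃ λ o → occ z u + occ o u + s ≡ occ z v + occ o v + t
    on-star-edge z with centre z ≟ z
    ... | no z-leaf = centre z , edge-shift z z-leaf
    ... | yes z-centre with two-leaves z z-centre
    ...   | l , _ , _ , (cl , l≢z) , _ = l , (begin
      occ z u + occ l u + s            ≡⟨ cong (λ k → occ k u + occ l u + s) (sym cl) ⟩
      occ (centre l) u + occ l u + s   ≡⟨ cong (_+ s) (+-comm (occ (centre l) u) (occ l u)) ⟩
      occ l u + occ (centre l) u + s   ≡⟨ edge-shift l (λ eq → l≢z (trans (sym eq) cl)) ⟩
      occ l v + occ (centre l) v + t   ≡⟨ cong (_+ t) (+-comm (occ l v) (occ (centre l) v)) ⟩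
      occ (centre l) v + occ l v + t   ≡⟨ cong (λ k → occ k v + occ l v + t) cl ⟩
      occ z v + occ l v + t            ∎)
      where open ≡-Reasoning

    s≤t : u ≢ v → s ≤ t
    s≤t u≢v with ∃-difference u≢v
    ... | z , zu , zv with on-star-edge z
    ...   | o , balance = +-cancelˡ-≤ 1 s t (begin
      1 + s                   ≤⟨ +-monoʳ-≤ 1 (m≤n+m s (occ o u)) ⟩
      1 + (occ o u + s)       ≡⟨ +-assoc 1 (occ o u) s ⟨
      1 + occ o u + s         ≡⟨ cong (λ k → k + occ o u + s) (sym zu) ⟩
      occ z u + occ o u + s   ≡⟨ balance ⟩
      occ z v + occ o v + t   ≡⟨ cong (λ k → k + occ o v + t) zv ⟩
      occ o v + t             ≤⟨ +-monoˡ-≤ t (occ≤1 o v) ⟩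
      1 + t                   ∎)
      where open ≤-Reasoning

  star-forest⇒unshifted : ∀ {u v} → Shifted D u v → u ≡ v
  star-forest⇒unshifted {u} {v} (s , t , shifted) with u ≟ᵥ v
  ... | yes u≡v = u≡v
  ... | no u≢v  = balanced⇒≡ balanced
    where
    s≡t : s ≡ t
    s≡t = ≤-antisym (s≤t u v s t shifted u≢v) (s≤t v u t s (sym ∘ shifted) (u≢v ∘ sym))
    balanced : Balanced u v
    balanced l l-leaf = +-cancelʳ-≡ s _ _
      (subst (λ k → occ l u + occ (centre l) u + s ≡ occ l v + occ (centre l) v + k) (sym s≡t)
             (edge-shift u v s t shifted l l-leaf))

-- The centres are the points below q; every z ≥ q is a leaf of z mod q, and c + q, c + 2q
-- are two leaves of the centre c because 3q ≤ n.
module Construction {n q : ℕ} .{{_ : ℕ.NonZero q}} (3q≤n : 3 * q ≤ n) where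

  q≤n : q ≤ n
  q≤n = ≤-trans (m≤m+n q (2 * q)) 3q≤n

  centre : Fin n → Fin n
  centre z = Fin.fromℕ< (<-≤-trans (m%n<n (toℕ z) q) q≤n)

  toℕ-centre : ∀ z → toℕ (centre z) ≡ toℕ z % q
  toℕ-centre z = Finₚ.toℕ-fromℕ< _

  centre-idem : ∀ z → centre (centre z) ≡ centre z
  centre-idem z = Finₚ.toℕ-injective (begin
    toℕ (centre (centre z))   ≡⟨ toℕ-centre (centre z) ⟩
    toℕ (centre z) % q        ≡⟨ cong (_% q) (toℕ-centre z) ⟩
    toℕ z % q % q             ≡⟨ m%n%n≡m%n (toℕ z) q ⟩
    toℕ z % q                 ≡⟨ toℕ-centre z ⟨
    toℕ (centre z)            ∎)
    where open ≡-Reasoning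

  centre⇒<q : ∀ {c} → centre c ≡ c → toℕ c < q
  centre⇒<q {c} c-centre = subst (_< q) (trans (sym (toℕ-centre c)) (cong toℕ c-centre)) (m%n<n (toℕ c) q)

  <q⇒centre : ∀ {c} → toℕ c < q → centre c ≡ c
  <q⇒centre {c} c<q = Finₚ.toℕ-injective (trans (toℕ-centre c) (m<n⇒m%n≡m c<q))

  lift : (c : Fin n) → toℕ c < q → (k : ℕ) → suc k ≤ 3 → Fin n
  lift c c<q k k<3 = Fin.fromℕ< (<-≤-trans (+-monoˡ-< (k * q) c<q) (≤-trans (*-monoˡ-≤ q k<3) 3q≤n))

  module _ {c : Fin n} (c<q : toℕ c < q) {k : ℕ} (k<3 : suc k ≤ 3) where

    toℕ-lift : toℕ (lift c c<q k k<3) ≡ toℕ c + k * q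
    toℕ-lift = Finₚ.toℕ-fromℕ< _

    centre-lift : centre (lift c c<q k k<3) ≡ c
    centre-lift = Finₚ.toℕ-injective (begin
      toℕ (centre (lift c c<q k k<3))   ≡⟨ toℕ-centre _ ⟩
      toℕ (lift c c<q k k<3) % q        ≡⟨ cong (_% q) toℕ-lift ⟩
      (toℕ c + k * q) % q               ≡⟨ [m+kn]%n≡m%n (toℕ c) k q ⟩
      toℕ c % q                         ≡⟨ m<n⇒m%n≡m c<q ⟩
      toℕ c                             ∎)
      where open ≡-Reasoning

  lift≢ : ∀ {c} (c<q : toℕ c < q) {k} (k<3 : suc (suc k) ≤ 3) → lift c c<q (suc k) k<3 ≢ c
  lift≢ {c} c<q {k} k<3 eq = <⇒≱ c<q (begin
    q                              ≤⟨ m≤m+n q (k * q) ⟩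
    suc k * q                      ≤⟨ m≤n+m (suc k * q) (toℕ c) ⟩
    toℕ c + suc k * q              ≡⟨ toℕ-lift c<q k<3 ⟨
    toℕ (lift c c<q (suc k) k<3)   ≡⟨ cong toℕ eq ⟩
    toℕ c                          ∎)
    where open ≤-Reasoning

  beyond : Fin (n ∸ q) → Fin n
  beyond i = Fin.fromℕ< (subst (q + toℕ i <_) (m+[n∸m]≡n q≤n) (+-monoʳ-< q (Finₚ.toℕ<n i)))

  toℕ-beyond : ∀ i → toℕ (beyond i) ≡ q + toℕ i
  toℕ-beyond i = Finₚ.toℕ-fromℕ< _

  edge : Fin (n ∸ q) → V n
  edge i = ⟨ centre (beyond i) , beyond i ∣ centre<beyond ⟩
    where
    centre<beyond : toℕ (centre (beyond i)) < toℕ (beyond i)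
    centre<beyond = subst₂ _<_ (sym (toℕ-centre (beyond i))) (sym (toℕ-beyond i))
                      (<-≤-trans (m%n<n (toℕ (beyond i)) q) (m≤m+n q (toℕ i)))

  D : List (V n)
  D = map edge (allFin (n ∸ q))

  D! : Unique D
  D! = Uniqueₚ.map⁺ edge-injective (Uniqueₚ.allFin⁺ (n ∸ q))
    where
    edge-injective : ∀ {i j} → edge i ≡ edge j → i ≡ j
    edge-injective {i} {j} eq = Finₚ.toℕ-injective (+-cancelˡ-≡ q (toℕ i) (toℕ j)
      (trans (sym (toℕ-beyond i)) (trans (cong (toℕ ∘ snd) eq) (toℕ-beyond j))))

  length-D : length D ≡ n ∸ q
  length-D = trans (length-map edge (allFin (n ∸ q))) (length-tabulate {n = n ∸ q} id)

  star-forest : StarForest D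
  star-forest = record
    { centre      = centre
    ; centre-idem = centre-idem
    ; two-leaves  = two-leaves
    ; star-edge   = star-edge
    }
    where
    two-leaves : ∀ c → centre c ≡ c →
                 ∃₂ λ l l′ → l ≢ l′ × (centre l ≡ c × l ≢ c) × (centre l′ ≡ c × l′ ≢ c)
    two-leaves c c-centre =
      l₁ , l₂ , l₁≢l₂ , (centre-lift c<q 1<3 , lift≢ c<q 1<3) , (centre-lift c<q 2<3 , lift≢ c<q 2<3)
      where
      c<q : toℕ c < q
      c<q = centre⇒<q c-centre
      1<3 : 2 ≤ 3
      1<3 = s≤s (s≤s z≤n)
      2<3 : 3 ≤ 3
      2<3 = ≤-refl
      l₁ l₂ : Fin n
      l₁ = lift c c<q 1 1<3
      l₂ = lift c c<q 2 2<3
      l₁≢l₂ : l₁ ≢ l₂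
      l₁≢l₂ eq with *-cancelʳ-≡ 1 2 q (+-cancelˡ-≡ (toℕ c) (1 * q) (2 * q)
                      (trans (sym (toℕ-lift c<q 1<3)) (trans (cong toℕ eq) (toℕ-lift c<q 2<3))))
      ... | ()
    star-edge : ∀ l → centre l ≢ l → ∃ λ x → x ∈ D × occ l x ≡ 1 × occ (centre l) x ≡ 1
    star-edge l l-leaf = edge i , ∈-map⁺ edge (∈-allFin i) ,
      subst (λ p → occ p (edge i) ≡ 1) beyond-i≡l (occ-snd (edge i)) ,
      subst (λ p → occ (centre p) (edge i) ≡ 1) beyond-i≡l (occ-fst (edge i))
      where
      q≤l : q ≤ toℕ l
      q≤l = ≮⇒≥ (l-leaf ∘ <q⇒centre)
      i : Fin (n ∸ q)
      i = Fin.fromℕ< (∸-monoˡ-< (Finₚ.toℕ<n l) q≤l)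
      beyond-i≡l : beyond i ≡ l
      beyond-i≡l = Finₚ.toℕ-injective
        (trans (toℕ-beyond i) (trans (cong (q +_) (Finₚ.toℕ-fromℕ< _)) (m+[n∸m]≡n q≤l)))

[3+m]/3 : ∀ m → (3 + m) / 3 ≡ 1 + m / 3
[3+m]/3 m = m/n≡1+[m∸n]/n (m≤m+n 3 m)

n∸n/3≡ceil2n/3 : ∀ n → n ∸ n / 3 ≡ ceil2n/3 n
n∸n/3≡ceil2n/3 0 = refl
n∸n/3≡ceil2n/3 1 = refl
n∸n/3≡ceil2n/3 2 = refl
n∸n/3≡ceil2n/3 (suc (suc (suc n))) = begin
  (3 + n) ∸ (3 + n) / 3         ≡⟨ cong ((3 + n) ∸_) ([3+m]/3 n) ⟩
  (2 + n) ∸ n / 3               ≡⟨ +-∸-assoc 2 (m/n≤m n 3) ⟩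
  2 + (n ∸ n / 3)               ≡⟨ cong (2 +_) (n∸n/3≡ceil2n/3 n) ⟩
  2 + (2 * n + 2) / 3           ≡⟨ cong suc ([3+m]/3 (2 * n + 2)) ⟨
  1 + (3 + (2 * n + 2)) / 3     ≡⟨ [3+m]/3 (3 + (2 * n + 2)) ⟨
  (3 + (3 + (2 * n + 2))) / 3   ≡⟨ cong (_/ 3) (solve 1 (λ n → con 3 :+ (con 3 :+ (con 2 :* n :+ con 2))
                                                             := con 2 :* (con 3 :+ n) :+ con 2) refl n) ⟩
  (2 * (3 + n) + 2) / 3         ∎
  where
  open ≡-Reasoning
  open +-*-Solver using (solve; _:+_; _:*_; _:=_; con)

ceil2n/3-least : ∀ {n m} → 2 * n ≤ 3 * m → ceil2n/3 n ≤ m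
ceil2n/3-least {n} {m} 2n≤3m = ≤-pred (m<n*o⇒m/o<n {2 * n + 2} {suc m} {3} (begin-strict
  2 * n + 2   <⟨ +-monoʳ-< (2 * n) (n<1+n 2) ⟩
  2 * n + 3   ≤⟨ +-monoˡ-≤ 3 (subst (2 * n ≤_) (*-comm 3 m) 2n≤3m) ⟩
  m * 3 + 3   ≡⟨ +-comm (m * 3) 3 ⟩
  suc m * 3   ∎))
  where open ≤-Reasoning

corollary1 : (n : ℕ) → 4 ≤ n → ψJ2≡ n (ceil2n/3 n)
corollary1 n 4≤n =
  (D , D! , resolving , trans length-D (n∸n/3≡ceil2n/3 n)) ,
  λ D′ D′! D′-resolving → ceil2n/3-least {n}
    (Resolving.lower-bound 3≤n D′ D′! (Equivalence.to (resolving⇔unshifted {D = D′}) D′-resolving))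
  where
  3≤n : 3 ≤ n
  3≤n = ≤-trans (n≤1+n 3) 4≤n
  open Construction {n} {n / 3} {{ℕ.>-nonZero (m≥n⇒m/n>0 3≤n)}}
                    (subst (_≤ n) (*-comm (n / 3) 3) (m/n*n≤m n 3))
  resolving : IsDoublyResolving D
  resolving = Equivalence.from (resolving⇔unshifted {D = D}) (star-forest⇒unshifted star-forest)
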